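{- Let $\mathbb{A}$ be a relational structure, $I$ a path instance of $\mathrm{CSP}(\mathbb{A})$, and $i\le j$. Then the relation $\lambda_{I,i,j}$ lies in the relational clone of $\mathbb{A}$.
   Context: A relational structure $\mathbb{A}=(A,\mathcal{R})$ is a finite set $A$ with finitely many basic relations. A path instance of $\mathrm{CSP}(\mathbb{A})$ of length $\ell$ has variables $[\ell]$, exactly one unary constraint on each $i$ with basic relation $B_i\subseteq A$, exactly one binary constraint on each $(i,i+1)$, $i<\ell$, with basic relation $B_{i,i+1}\subseteq A^2$, and no other constraints. $I_{[i,j]}$ is the restriction of $I$ to the variables $i,\dots,j$. The graph $\mathrm{Conn}(I_{[i,j]})$ has as vertices the disjoint union of $B_i,\dots,B_j$, and for each $k\in[i,j)$ an edge between $x\in B_k$ and $y\in B_{k+1}$ whenever $(x,y)\in B_{k,k+1}$. The relation $\lambda_{I,i,j}\subseteq A^2$ consists of all pairs $(a,b)$ with $a\in B_i$, $b\in B_j$ such that there is a path (ignoring edge orientation) from $a$ (in the copy $B_i$) to $b$ (in the copy $B_j$) in $\mathrm{Conn}(I_{[i,j]})$. The relational clone of $\mathbb{A}$ is the set of all relations on $A$ definable by primitive positive formulas (existentially quantified conjunctions of atoms $R(x_{1},\dots,x_{m})$ with $R$ basic, variables possibly repeated) from the basic relations of $\mathbb{A}$. -}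

module Defs where

open import Data.Nat using (ℕ; zero; suc; _+_; _≤_)
open import Data.Fin using (Fin; toℕ; inject₁) renaming (suc to fsuc)
open import Data.Vec using (Vec; []; _∷_; lookup; _++_)
open import Data.Bool using (Bool; T)
open import Data.List using (List)
open import Data.List.Relation.Unary.All using (All)
open import Data.Product using (Σ; _×_; _,_; ∃)
open import Relation.Binary.PropositionalEquality using (_≡_; subst; sym)
open import Relation.Binary.Construct.Closure.Symmetric using (SymClosure)
open import Relation.Binary.Construct.Closure.ReflexiveTransitive using (Star)

record Structure : Set where
  field
    n     : ℕ
    r     : ℕ
    arity : Fin r → ℕ
    rel   : (k : Fin r) → Vec (Fin n) (arity k) → Bool

  Carrier : Set
  Carrier = Fin n

  _∋ʳ_ : (k : Fin r) → Vec Carrier (arity k) → Set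
  k ∋ʳ v = T (rel k v)

-- Variables are 0,…,m (length ℓ = m+1);
-- the unary constraint on variable i uses a basic relation of arity 1,
-- the binary constraint on (e, e+1) (e : Fin m) uses one of arity 2.

module _ (𝔸 : Structure) where
  open Structure 𝔸

  record PathInstance : Set where
    field
      m          : ℕ
      unary      : Fin (suc m) → Fin r
      unary-ar   : (i : Fin (suc m)) → arity (unary i) ≡ 1
      binary     : Fin m → Fin r
      binary-ar  : (e : Fin m) → arity (binary e) ≡ 2

    B : Fin (suc m) → Carrier → Set
    B i a = unary i ∋ʳ subst (Vec Carrier) (sym (unary-ar i)) (a ∷ [])

    Bₑ : Fin m → Carrier → Carrier → Set
    Bₑ e x y = binary e ∋ʳ subst (Vec Carrier) (sym (binary-ar e)) (x ∷ y ∷ [])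

    -- vertices of Conn(I_[i,j]): disjoint union of B_i, …, B_j
    Vertex : Fin (suc m) → Fin (suc m) → Set
    Vertex i j = Σ (Fin (suc m)) λ k →
                   (toℕ i ≤ toℕ k × toℕ k ≤ toℕ j) × Σ Carrier (B k)

    Edge : ∀ {i j} → Vertex i j → Vertex i j → Set
    Edge (k₁ , _ , x , _) (k₂ , _ , y , _) =
      Σ (Fin m) λ e → k₁ ≡ inject₁ e × k₂ ≡ fsuc e × Bₑ e x y

    Connected : ∀ {i j} → Vertex i j → Vertex i j → Set
    Connected = Star (SymClosure Edge)

    λ-rel : (i j : Fin (suc m)) → toℕ i ≤ toℕ j → Carrier → Carrier → Set
    λ-rel i j i≤j a b =
      Σ (B i a) λ a∈ → Σ (B j b) λ b∈ →
        Connected {i} {j} (i , (Data.Nat.Properties.≤-refl , i≤j) , a , a∈)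
                          (j , (i≤j , Data.Nat.Properties.≤-refl) , b , b∈)
      where import Data.Nat.Properties

-- Primitive positive formulas with p free variables (indices 0..p-1 of
-- the variable vector) and q existentially quantified ones (p..p+q-1).

  data Atom (v : ℕ) : Set where
    rel-atom : (k : Fin r) → Vec (Fin v) (arity k) → Atom v
    eq-atom  : Fin v → Fin v → Atom v

  record PPFormula (p : ℕ) : Set where
    field
      q     : ℕ
      atoms : List (Atom (p + q))

  ⟦_⟧ᵃ : ∀ {v} → Atom v → Vec Carrier v → Set
  ⟦ rel-atom k xs ⟧ᵃ σ = k ∋ʳ Data.Vec.map (λ x → lookup σ x) xs
  ⟦ eq-atom x y ⟧ᵃ σ = lookup σ x ≡ lookup σ y

  ⟦_⟧ : ∀ {p} → PPFormula p → Vec Carrier p → Set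
  ⟦ φ ⟧ v = ∃ λ (w : Vec Carrier (PPFormula.q φ)) →
              All (λ α → ⟦ α ⟧ᵃ (v ++ w)) (PPFormula.atoms φ)

  InRelClone : (p : ℕ) → (Vec Carrier p → Set) → Set
  InRelClone p R = Σ (PPFormula p) λ φ →
    ∀ v → (R v → ⟦ φ ⟧ v) × (⟦ φ ⟧ v → R v)

λ-tuple : (𝔸 : Structure) (I : PathInstance 𝔸) (i j : Fin (suc (PathInstance.m I))) →
          toℕ i ≤ toℕ j → Vec (Structure.Carrier 𝔸) 2 → Set
λ-tuple 𝔸 I i j i≤j (a ∷ b ∷ []) = PathInstance.λ-rel I i j i≤j a b

module Submission where

-- Conn(I_[i,j]) is a layered graph: layer k consists of the elements of B_k, and edges join
-- adjacent layers.  Fix a profile, i.e. a sequence of layers H 0 = i, H 1, …, H T = j moving by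
-- one at each step.  The pairs (a, b) joined by a walk through exactly the layers H 0, …, H T
-- form a pp-definable relation: the diagonal of B_i composed with one edge relation B_{k,k+1},
-- read upwards or downwards, per step.  It therefore suffices to find one profile U along which
-- every connected pair is joined.  A connecting walk can be shortened to at most K steps (K the
-- number of vertices), and there are finitely many profiles of length at most K.  By the mountain
-- climbing theorem any two profiles are followed by a common one (walkers on both can move in
-- step at equal heights); merging all short profiles gives U, and a walk with profile g, read
-- along a route by which U follows g, is a walk through the layers of U.

open import Defs
open import Data.Nat using (suc; _≤_)
open import Data.Fin using (Fin; toℕ)
open import Data.Nat.Properties using (≤-refl)

module PPClosure (𝔸 : Structure) where
  open import Data.Nat using (ℕ; suc; _+_)
  open import Data.Fin using (Fin; zero; suc; _↑ˡ_; _↑ʳ_)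
  open import Data.Vec using (Vec; []; _∷_; _++_; lookup; map; splitAt)
  open import Data.Vec.Properties using (map-∘; map-cong; lookup-++ˡ; lookup-++ʳ)
  open import Data.List as List using (List)
  open import Data.List.Relation.Unary.All as All using (All)
  open import Data.List.Relation.Unary.All.Properties using (map⁺; map⁻; ++⁺; ++⁻)
  open import Data.Product using (∃; _×_; _,_; proj₁; proj₂)
  open import Function using (_∘_; id)
  open import Relation.Binary.PropositionalEquality

  open Structure 𝔸 using (Carrier; _∋ʳ_)

  _≐_ : ∀ {p} → (Vec Carrier p → Set) → (Vec Carrier p → Set) → Set
  R ≐ S = ∀ v → (R v → S v) × (S v → R v)

  InRelClone-resp : ∀ {p} {R S : Vec Carrier p → Set} → R ≐ S →
                    InRelClone 𝔸 p R → InRelClone 𝔸 p S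
  InRelClone-resp R≐S (φ , R≐φ) = φ , λ v →
    (λ s → proj₁ (R≐φ v) (proj₂ (R≐S v) s)) , (λ f → proj₁ (R≐S v) (proj₂ (R≐φ v) f))

  rename : ∀ {u v} → (Fin u → Fin v) → Atom 𝔸 u → Atom 𝔸 v
  rename ρ (rel-atom k xs) = rel-atom k (map ρ xs)
  rename ρ (eq-atom x y)   = eq-atom (ρ x) (ρ y)

  rename-sem : ∀ {u v} (ρ : Fin u → Fin v) {σ : Vec Carrier v} {τ : Vec Carrier u} →
               (∀ x → lookup τ x ≡ lookup σ (ρ x)) →
               ∀ α → ⟦_⟧ᵃ 𝔸 (rename ρ α) σ ≡ ⟦_⟧ᵃ 𝔸 α τ
  rename-sem ρ {σ} {τ} τ≡σρ (rel-atom k xs) = cong (k ∋ʳ_) (begin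
    map (lookup σ) (map ρ xs) ≡⟨ map-∘ (lookup σ) ρ xs ⟨
    map (lookup σ ∘ ρ) xs     ≡⟨ map-cong (sym ∘ τ≡σρ) xs ⟩
    map (lookup τ) xs         ∎)
    where open ≡-Reasoning
  rename-sem ρ τ≡σρ (eq-atom x y) = sym (cong₂ _≡_ (τ≡σρ x) (τ≡σρ y))

  module _ {u v} (ρ : Fin u → Fin v) {σ : Vec Carrier v} {τ : Vec Carrier u}
           (τ≡σρ : ∀ x → lookup τ x ≡ lookup σ (ρ x)) where
    rename-all⁺ : ∀ {αs} → All (λ α → ⟦_⟧ᵃ 𝔸 α τ) αs →
                  All (λ α → ⟦_⟧ᵃ 𝔸 α σ) (List.map (rename ρ) αs)
    rename-all⁺ holds = map⁺ (All.map (λ {α} → subst id (sym (rename-sem ρ {σ} {τ} τ≡σρ α))) holds)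

    rename-all⁻ : ∀ αs → All (λ α → ⟦_⟧ᵃ 𝔸 α σ) (List.map (rename ρ) αs) →
                  All (λ α → ⟦_⟧ᵃ 𝔸 α τ) αs
    rename-all⁻ αs holds = All.map (λ {α} → subst id (rename-sem ρ {σ} {τ} τ≡σρ α)) (map⁻ holds)

  _⨾_ : (Vec Carrier 2 → Set) → (Vec Carrier 2 → Set) → Vec Carrier 2 → Set
  (R ⨾ S) (x ∷ z ∷ []) = ∃ λ y → R (x ∷ y ∷ []) × S (y ∷ z ∷ [])

  -- The relational clone is closed under composition: ∃y. φ(x,y) ∧ ψ(y,z), where
  -- the variables are laid out as x, z, y, then the bound variables of φ and of ψ.
  InRelClone-⨾ : ∀ {R S} → InRelClone 𝔸 2 R → InRelClone 𝔸 2 S → InRelClone 𝔸 2 (R ⨾ S)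
  InRelClone-⨾ {R} {S} (φ , R≐φ) (ψ , S≐ψ) = χ , R⨾S≐χ
    where
    q₁ q₂ : ℕ
    q₁ = PPFormula.q φ
    q₂ = PPFormula.q ψ

    ρ₁ : Fin (2 + q₁) → Fin (3 + (q₁ + q₂))
    ρ₁ zero          = zero
    ρ₁ (suc zero)    = suc (suc zero)
    ρ₁ (suc (suc k)) = suc (suc (suc (k ↑ˡ q₂)))

    ρ₂ : Fin (2 + q₂) → Fin (3 + (q₁ + q₂))
    ρ₂ zero          = suc (suc zero)
    ρ₂ (suc zero)    = suc zero
    ρ₂ (suc (suc k)) = suc (suc (suc (q₁ ↑ʳ k)))

    χ : PPFormula 𝔸 2
    χ = record { q = suc (q₁ + q₂)
               ; atoms = List.map (rename ρ₁) (PPFormula.atoms φ)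
                         List.++ List.map (rename ρ₂) (PPFormula.atoms ψ) }

    module _ (x z y : Carrier) (w₁ : Vec Carrier q₁) (w₂ : Vec Carrier q₂) where
      σ : Vec Carrier (3 + (q₁ + q₂))
      σ = x ∷ z ∷ y ∷ (w₁ ++ w₂)

      pull₁ : ∀ k → lookup (x ∷ y ∷ w₁) k ≡ lookup σ (ρ₁ k)
      pull₁ zero          = refl
      pull₁ (suc zero)    = refl
      pull₁ (suc (suc k)) = sym (lookup-++ˡ w₁ w₂ k)

      pull₂ : ∀ k → lookup (y ∷ z ∷ w₂) k ≡ lookup σ (ρ₂ k)
      pull₂ zero          = refl
      pull₂ (suc zero)    = refl
      pull₂ (suc (suc k)) = sym (lookup-++ʳ w₁ w₂ k)

    R⨾S≐χ : (R ⨾ S) ≐ ⟦_⟧ 𝔸 χ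
    R⨾S≐χ (x ∷ z ∷ []) = complete , sound
      where
      complete : (R ⨾ S) (x ∷ z ∷ []) → ⟦_⟧ 𝔸 χ (x ∷ z ∷ [])
      complete (y , r , s) with proj₁ (R≐φ (x ∷ y ∷ [])) r | proj₁ (S≐ψ (y ∷ z ∷ [])) s
      ... | w₁ , holds₁ | w₂ , holds₂ =
        y ∷ (w₁ ++ w₂) ,
        ++⁺ (rename-all⁺ ρ₁ (pull₁ x z y w₁ w₂) holds₁) (rename-all⁺ ρ₂ (pull₂ x z y w₁ w₂) holds₂)

      sound : ⟦_⟧ 𝔸 χ (x ∷ z ∷ []) → (R ⨾ S) (x ∷ z ∷ [])
      sound (y ∷ w , holds) with splitAt q₁ w
      ... | w₁ , w₂ , refl with ++⁻ (List.map (rename ρ₁) (PPFormula.atoms φ)) holds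
      ...   | holds₁ , holds₂ =
        y , proj₂ (R≐φ (x ∷ y ∷ [])) (w₁ , rename-all⁻ ρ₁ (pull₁ x z y w₁ w₂) _ holds₁)
          , proj₂ (S≐ψ (y ∷ z ∷ [])) (w₂ , rename-all⁻ ρ₂ (pull₂ x z y w₁ w₂) _ holds₂)

module Positions where
  open import Data.Nat
  open import Data.Nat.Properties
  open import Data.Product using (Σ; _×_; _,_)
  open import Data.Sum using (_⊎_; inj₁; inj₂)
  open import Data.Empty using (⊥-elim)
  open import Relation.Nullary using (¬_; Dec; yes; no; _⊎-dec_)
  open import Relation.Unary using (Decidable)
  open import Relation.Binary.PropositionalEquality

  Adj : ℕ → ℕ → Set
  Adj a b = suc a ≡ b ⊎ suc b ≡ a

  Adj-sym : ∀ {a b} → Adj a b → Adj b a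
  Adj-sym (inj₁ e) = inj₂ e
  Adj-sym (inj₂ e) = inj₁ e

  below-suc : ∀ {Q : ℕ → Set} {n} → (∀ p → p < n → Q p) → Q n → ∀ p → p < suc n → Q p
  below-suc {n = n} below atN p p<1+n with m≤n⇒m<n∨m≡n (≤-pred p<1+n)
  ... | inj₁ p<n  = below p p<n
  ... | inj₂ refl = atN

  module _ {P : ℕ → Set} (P? : Decidable P) (f : ℕ → ℕ) where
    Least : ℕ → ℕ → Set
    Least n p = p < n × P p × (∀ p' → p' < n → P p' → f p ≤ f p')

    argmin : ∀ n → (∀ p → p < n → ¬ P p) ⊎ Σ ℕ (Least n)
    argmin zero = inj₁ λ _ ()
    argmin (suc n) with argmin n | P? n
    ... | inj₁ none | no ¬Pn = inj₁ (below-suc none ¬Pn)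
    ... | inj₁ none | yes Pn =
      inj₂ (n , ≤-refl , Pn , below-suc (λ p' p'<n Pp' → ⊥-elim (none p' p'<n Pp')) (λ _ → ≤-refl))
    ... | inj₂ (p , p<n , Pp , least) | Pn? with f p ≤? f n | Pn?
    ...   | yes fp≤fn | _ = inj₂ (p , m≤n⇒m≤1+n p<n , Pp , below-suc least (λ _ → fp≤fn))
    ...   | no fp≰fn | yes Pn = inj₂ (n , ≤-refl , Pn ,
            below-suc (λ p' p'<n Pp' → ≤-trans (<⇒≤ (≰⇒> fp≰fn)) (least p' p'<n Pp')) (λ _ → ≤-refl))
    ...   | no _ | no ¬Pn = inj₂ (p , m≤n⇒m≤1+n p<n , Pp , below-suc least (λ Pn → ⊥-elim (¬Pn Pn)))

  -- jump e p renumbers positions after e positions following p were cut out: positions up to p stay,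
  -- later ones move up by e.
  jump : ℕ → ℕ → ℕ → ℕ
  jump e p       zero    = zero
  jump e zero    (suc r) = e + suc r
  jump e (suc p) (suc r) = suc (jump e p r)

  jump-low : ∀ {e p r} → r ≤ p → jump e p r ≡ r
  jump-low {r = zero}        _   = refl
  jump-low {p = suc p} {suc r} r≤p = cong suc (jump-low (≤-pred r≤p))

  jump-high : ∀ {e p r} → p < r → jump e p r ≡ e + r
  jump-high {p = zero}  {suc r} _   = refl
  jump-high {e} {suc p} {suc r} p<r = trans (cong suc (jump-high (≤-pred p<r))) (sym (+-suc e r))

  steps-adjacent : ∀ {A : Set} {R : A → A → Set} → (∀ {x y} → R x y → R y x) →
                   ∀ {h : ℕ → A} {L} → (∀ t → t < L → R (h t) (h (suc t))) →
                   ∀ {a b} → a ≤ L → b ≤ L → Adj a b → R (h a) (h b)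
  steps-adjacent R-sym steps _   b≤L (inj₁ refl) = steps _ b≤L
  steps-adjacent R-sym steps a≤L _   (inj₂ refl) = R-sym (steps _ a≤L)

  all-below? : ∀ {P : ℕ → Set} → Decidable P → ∀ n → Dec (∀ p → p < n → P p)
  all-below? P? zero = yes λ _ ()
  all-below? P? (suc n) with all-below? P? n | P? n
  ... | yes below | yes Pn = yes (below-suc below Pn)
  ... | no ¬below | _      = no λ all → ¬below λ p p<n → all p (m<n⇒m<1+n p<n)
  ... | yes _     | no ¬Pn = no λ all → ¬Pn (all n ≤-refl)

  adj? : ∀ a b → Dec (Adj a b)
  adj? a b = (suc a ≟ b) ⊎-dec (suc b ≟ a)

-- Profiles and the mountain climbing theorem.
module MountainClimbing where
  open Positions
  open import Data.Nat
  open import Data.Nat.Properties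
  open import Data.Product using (Σ; _×_; _,_; proj₁; proj₂)
  open import Data.Sum using (_⊎_; inj₁; inj₂)
  open import Data.Empty using (⊥-elim)
  open import Relation.Nullary using (¬_; yes; no)
  open import Relation.Unary using (Decidable)
  open import Relation.Binary.PropositionalEquality
  open import Relation.Binary.Definitions using (tri<; tri≈; tri>)

  record Profile (lo hi : ℕ) : Set where
    field
      len     : ℕ
      height  : ℕ → ℕ
      starts  : height 0 ≡ lo
      ends    : height len ≡ hi
      bounded : ∀ t → t ≤ len → lo ≤ height t × height t ≤ hi
      steps   : ∀ t → t < len → Adj (height t) (height (suc t))
  open Profile

  -- Position suc p is a peak of the heights F (of length len): both its neighbours are one lower.
  Peak : (ℕ → ℕ) → ℕ → ℕ → Set
  Peak F len p = suc p < len × suc (F p) ≡ F (suc p) × suc (F (suc (suc p))) ≡ F (suc p)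

  peak? : ∀ F len → Decidable (Peak F len)
  peak? F len p with suc p <? len | suc (F p) ≟ F (suc p) | suc (F (suc (suc p))) ≟ F (suc p)
  ... | yes a | yes b | yes c = yes (a , b , c)
  ... | no ¬a | _     | _     = no λ pk → ¬a (proj₁ pk)
  ... | yes _ | no ¬b | _     = no λ pk → ¬b (proj₁ (proj₂ pk))
  ... | yes _ | yes _ | no ¬c = no λ pk → ¬c (proj₂ (proj₂ pk))

  PeaksFrom : (ℕ → ℕ) → ℕ → ℕ → Set
  PeaksFrom G n d = ∀ q → Peak G n q → d ≤ G (suc q)

  lowestPeak : ∀ F len → (∀ p → ¬ Peak F len p) ⊎ Σ ℕ λ p → Peak F len p × PeaksFrom F len (F (suc p))
  lowestPeak F len with argmin (peak? F len) (λ p → F (suc p)) len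
  ... | inj₁ none = inj₁ λ p pk → none p (inBounds pk) pk
    where inBounds : ∀ {p} → Peak F len p → p < len
          inBounds pk = <-trans (n<1+n _) (proj₁ pk)
  ... | inj₂ (p , _ , pk , least) = inj₂ (p , pk , λ q qk → least q (<-trans (n<1+n q) (proj₁ qk)) qk)

  -- Two climbers, at positions p of F (length m) and q of G (length n), can reach the ends (m , n)
  -- by simultaneous moves to adjacent positions, being at equal heights after every move.
  data Sync (F G : ℕ → ℕ) (m n : ℕ) : ℕ → ℕ → Set where
    arrived : Sync F G m n m n
    move    : ∀ {p q p' q'} → Adj p p' → Adj q q' → p' ≤ m → q' ≤ n → F p' ≡ G q' →
              Sync F G m n p' q' → Sync F G m n p q

  Sync-swap : ∀ {F G m n p q} → Sync F G m n p q → Sync G F n m q p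
  Sync-swap arrived                = arrived
  Sync-swap (move a b p≤ q≤ e s) = move b a q≤ p≤ (sym e) (Sync-swap s)

  module _ {lo hi} (f : Profile lo hi) (peakless : ∀ p → ¬ Peak (height f) (len f) p) where
    rising : ∀ t → t < len f → suc (height f t) ≡ height f (suc t)
    rising t t<len with steps f t t<len
    ... | inj₁ up = up
    rising zero t<len | inj₂ down =
      ⊥-elim (<-irrefl refl (≤-trans (≤-reflexive (trans down (starts f))) (proj₁ (bounded f 1 t<len))))
    rising (suc t) t<len | inj₂ down = ⊥-elim (peakless t (t<len , rising t (<⇒≤ t<len) , down))

    rising-heights : ∀ t → t ≤ len f → height f t ≡ lo + t
    rising-heights zero _       = trans (starts f) (sym (+-identityʳ lo))
    rising-heights (suc t) t<len = begin
      height f (suc t) ≡⟨ rising t t<len ⟨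
      suc (height f t) ≡⟨ cong suc (rising-heights t (<⇒≤ t<len)) ⟩
      suc (lo + t)     ≡⟨ +-suc lo t ⟨
      lo + suc t       ∎
      where open ≡-Reasoning

  -- Two peakless profiles coincide, so the climbers simply walk up side by side.
  peakless-sync : ∀ {lo hi} (f g : Profile lo hi) →
                  (∀ p → ¬ Peak (height f) (len f) p) → (∀ q → ¬ Peak (height g) (len g) q) →
                  Sync (height f) (height g) (len f) (len g) 0 0
  peakless-sync {lo} f g f-peakless g-peakless = lockstep (len f) 0 (+-identityʳ (len f))
    where
    same-len : len f ≡ len g
    same-len = +-cancelˡ-≡ lo _ _ (begin
      lo + len f     ≡⟨ rising-heights f f-peakless (len f) ≤-refl ⟨
      height f (len f) ≡⟨ trans (ends f) (sym (ends g)) ⟩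
      height g (len g) ≡⟨ rising-heights g g-peakless (len g) ≤-refl ⟩
      lo + len g     ∎)
      where open ≡-Reasoning

    lockstep : ∀ k t → k + t ≡ len f → Sync (height f) (height g) (len f) (len g) t t
    lockstep zero t refl rewrite same-len = arrived
    lockstep (suc k) t k+t≡len =
      move (inj₁ refl) (inj₁ refl) t<f t<g
           (trans (rising-heights f f-peakless (suc t) t<f) (sym (rising-heights g g-peakless (suc t) t<g)))
           (lockstep k (suc t) (trans (+-suc k t) k+t≡len))
      where
      t<f : t < len f
      t<f = subst (t <_) k+t≡len (m<n+m t z<s)
      t<g : t < len g
      t<g = subst (t <_) same-len t<f

  -- Let suc p be a peak of f, of height d, such that no peak of g is lower.
  -- Cutting the positions suc p and suc (suc p) out of f gives a shorter profile, and every
  -- synchronisation of it with g lifts to one of f with g: whenever the cut climber passes the cut,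
  -- the f-climber crosses the peak while the g-climber, standing at height d - 1, steps up to a
  -- neighbour at height d and back.
  module PeakRemoval {lo hi} (f g : Profile lo hi) (p : ℕ) (peak : Peak (height f) (len f) p)
                     (lowest : PeaksFrom (height g) (len g) (height f (suc p))) where
    F G : ℕ → ℕ
    F = height f
    G = height g

    m n d : ℕ
    m = len f
    n = len g
    d = F (suc p)

    rise : suc (F p) ≡ d
    rise = proj₁ (proj₂ peak)

    fall : suc (F (suc (suc p))) ≡ d
    fall = proj₂ (proj₂ peak)

    feet : F (suc (suc p)) ≡ F p
    feet = suc-injective (trans fall (sym rise))

    d≤hi : d ≤ hi
    d≤hi = proj₂ (bounded f (suc p) (<⇒≤ (proj₁ peak)))

    -- The peak is not at the end, since the end is the highest point.
    beyond-peak : suc (suc (suc p)) ≤ m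
    beyond-peak with m≤n⇒m<n∨m≡n (proj₁ peak)
    ... | inj₁ 2+p<m  = 2+p<m
    ... | inj₂ 2+p≡m = ⊥-elim (<-irrefl refl (≤-trans (≤-reflexive (trans (cong suc hi≡) fall)) d≤hi))
      where
      hi≡ : hi ≡ F (suc (suc p))
      hi≡ = trans (sym (ends f)) (cong F (sym 2+p≡m))

    rest : ℕ
    rest = proj₁ (m≤n⇒∃[o]m+o≡n beyond-peak)

    cut-len : ℕ
    cut-len = suc (p + rest)

    cut-len+2≡m : suc (suc cut-len) ≡ m
    cut-len+2≡m = proj₂ (m≤n⇒∃[o]m+o≡n beyond-peak)

    jump-end : jump 2 p cut-len ≡ m
    jump-end = trans (jump-high (s≤s (m≤m+n p rest))) cut-len+2≡m

    jump-bounded : ∀ {r} → r ≤ cut-len → jump 2 p r ≤ m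
    jump-bounded {r} r≤ with r ≤? p
    ... | yes r≤p = subst (_≤ m) (sym (jump-low r≤p))
                          (≤-trans r≤p (≤-trans (n≤1+n p) (≤-trans (n≤1+n _) (<⇒≤ beyond-peak))))
    ... | no r≰p  = subst (_≤ m) (sym (jump-high (≰⇒> r≰p)))
                          (subst (suc (suc r) ≤_) cut-len+2≡m (s≤s (s≤s r≤)))

    data Crossing (r r' : ℕ) : Set where
      apart    : Adj (jump 2 p r) (jump 2 p r') → Crossing r r'
      upward   : r ≡ p → r' ≡ suc p → Crossing r r'
      downward : r ≡ suc p → r' ≡ p → Crossing r r'

    crossing-swap : ∀ {r r'} → Crossing r r' → Crossing r' r
    crossing-swap (apart a)      = apart (Adj-sym a)
    crossing-swap (upward a b)   = downward b a
    crossing-swap (downward a b) = upward b a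

    crossing-up : ∀ r → Crossing r (suc r)
    crossing-up r with <-cmp r p
    ... | tri< r<p _ _ = apart (subst₂ Adj (sym (jump-low (<⇒≤ r<p))) (sym (jump-low r<p)) (inj₁ refl))
    ... | tri≈ _ r≡p _ = upward r≡p (cong suc r≡p)
    ... | tri> _ _ p<r = apart (subst₂ Adj (sym (jump-high p<r)) (sym (jump-high (m<n⇒m<1+n p<r))) (inj₁ refl))

    crossing : ∀ {r r'} → Adj r r' → Crossing r r'
    crossing (inj₁ refl) = crossing-up _
    crossing (inj₂ refl) = crossing-swap (crossing-up _)

    cut : Profile lo hi
    cut = record
      { len     = cut-len
      ; height  = λ r → F (jump 2 p r)
      ; starts  = starts f
      ; ends    = trans (cong F jump-end) (ends f)
      ; bounded = λ r r≤ → bounded f (jump 2 p r) (jump-bounded r≤)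
      ; steps   = λ r r< → cut-step r (crossing-up r) (jump-bounded (<⇒≤ r<)) (jump-bounded r<)
      }
      where
      cut-step : ∀ r → Crossing r (suc r) → jump 2 p r ≤ m → jump 2 p (suc r) ≤ m →
                 Adj (F (jump 2 p r)) (F (jump 2 p (suc r)))
      cut-step r (apart r~r') ≤m ≤m' = steps-adjacent {R = Adj} Adj-sym {h = F} (steps f) ≤m ≤m' r~r'
      cut-step r (upward refl _) _ _ =
        subst₂ Adj (trans feet (cong F (sym (jump-low ≤-refl))))
                   (cong F (sym (jump-high {2} {p} {suc p} (n<1+n p))))
               (steps f (suc (suc p)) beyond-peak)
      cut-step r (downward refl r≡p) _ _ = ⊥-elim (<-irrefl (sym r≡p) (m<n⇒m<1+n (n<1+n p)))

    -- At height d - 1 the g-climber has a neighbour at height d: the end of g is not below d, its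
    -- start is not above d - 1, and elsewhere two lower neighbours would make a peak below d.
    ascent : ∀ {q} → q ≤ n → suc (G q) ≡ d → Σ ℕ λ q* → Adj q q* × q* ≤ n × G q* ≡ d
    ascent {q} q≤n Gq+1≡d with m≤n⇒m<n∨m≡n q≤n
    ... | inj₂ refl =
      ⊥-elim (<-irrefl refl (≤-trans (≤-reflexive (trans (cong suc (sym (ends g))) Gq+1≡d)) d≤hi))
    ascent {zero} q≤n Gq+1≡d | inj₁ 0<n with steps g 0 0<n
    ... | inj₁ up   = 1 , inj₁ refl , 0<n , trans (sym up) Gq+1≡d
    ... | inj₂ down =
      ⊥-elim (<-irrefl refl (≤-trans (≤-reflexive (trans down (starts g))) (proj₁ (bounded g 1 0<n))))
    ascent {suc q} q≤n Gq+1≡d | inj₁ 1+q<n with steps g q (<⇒≤ 1+q<n) | steps g (suc q) 1+q<n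
    ... | inj₂ down | _         = q , inj₂ refl , <⇒≤ (<⇒≤ 1+q<n) , trans (sym down) Gq+1≡d
    ... | inj₁ _    | inj₁ up   = suc (suc q) , inj₁ refl , 1+q<n , trans (sym up) Gq+1≡d
    ... | inj₁ up   | inj₂ down =
      ⊥-elim (<-irrefl refl (≤-trans (≤-reflexive Gq+1≡d) (lowest q (1+q<n , up , down))))

    level-with-foot : ∀ {q} → F p ≡ G q → suc (G q) ≡ d
    level-with-foot Fp≡Gq = trans (cong suc (sym Fp≡Gq)) rise

    over-upward : ∀ {q q'} → q ≤ n → F p ≡ G q → Adj q q' → q' ≤ n → F (suc (suc (suc p))) ≡ G q' →
                  Sync F G m n (suc (suc (suc p))) q' → Sync F G m n p q
    over-upward {q} q≤n Fp≡Gq aq q'≤n e rest with ascent q≤n (level-with-foot Fp≡Gq)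
    ... | q* , aq* , q*≤n , Gq*≡d =
      move (inj₁ refl) aq* (<⇒≤ (proj₁ peak)) q*≤n (sym Gq*≡d)
        (move (inj₁ refl) (Adj-sym aq*) (<⇒≤ beyond-peak) q≤n (trans feet Fp≡Gq)
          (move (inj₁ refl) aq beyond-peak q'≤n e rest))

    over-downward : ∀ {q q'} → Adj q q' → q' ≤ n → F p ≡ G q' →
                    Sync F G m n p q' → Sync F G m n (suc (suc (suc p))) q
    over-downward aq q'≤n Fp≡Gq' rest with ascent q'≤n (level-with-foot Fp≡Gq')
    ... | q* , aq* , q*≤n , Gq*≡d =
      move (inj₂ refl) aq (<⇒≤ beyond-peak) q'≤n (trans feet Fp≡Gq')
        (move (inj₂ refl) aq* (<⇒≤ (proj₁ peak)) q*≤n (sym Gq*≡d)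
          (move (inj₂ refl) (Adj-sym aq*) (≤-trans (n≤1+n p) (<⇒≤ (proj₁ peak))) q'≤n Fp≡Gq' rest))

    lift : ∀ {r q} → q ≤ n → F (jump 2 p r) ≡ G q →
           Sync (height cut) G cut-len n r q → Sync F G m n (jump 2 p r) q
    lift _ _ arrived = subst (λ x → Sync F G m n x n) (sym jump-end) arrived
    lift q≤n e₀ (move {p' = r'} ar aq r'≤ q'≤n e s) with crossing ar
    ... | apart a = move a aq (jump-bounded r'≤) q'≤n e (lift q'≤n e s)
    ... | upward refl refl =
      subst (λ x → Sync F G m n x _) (sym (jump-low ≤-refl))
        (over-upward q≤n (trans (cong F (sym (jump-low ≤-refl))) e₀) aq q'≤n
          (trans (cong F (sym (jump-high (n<1+n p)))) e)
          (subst (λ x → Sync F G m n x _) (jump-high (n<1+n p)) (lift q'≤n e s)))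
    ... | downward refl refl =
      subst (λ x → Sync F G m n x _) (sym (jump-high (n<1+n p)))
        (over-downward aq q'≤n (trans (cong F (sym (jump-low ≤-refl))) e)
          (subst (λ x → Sync F G m n x _) (jump-low ≤-refl) (lift q'≤n e s)))

    uncut : Sync (height cut) G cut-len n 0 0 → Sync F G m n 0 0
    uncut = lift z≤n (trans (starts f) (sym (starts g)))

    cut-shorter : cut-len < m
    cut-shorter = subst (cut-len <_) cut-len+2≡m (m<n⇒m<1+n (n<1+n cut-len))

  data LowerPeak {lo hi} (f g : Profile lo hi) : Set where
    no-peaks : (∀ p → ¬ Peak (height f) (len f) p) → (∀ q → ¬ Peak (height g) (len g) q) →
               LowerPeak f g
    left     : ∀ p → Peak (height f) (len f) p → PeaksFrom (height g) (len g) (height f (suc p)) →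
               LowerPeak f g
    right    : ∀ q → Peak (height g) (len g) q → PeaksFrom (height f) (len f) (height g (suc q)) →
               LowerPeak f g

  lowerPeak : ∀ {lo hi} (f g : Profile lo hi) → LowerPeak f g
  lowerPeak f g with lowestPeak (height f) (len f) | lowestPeak (height g) (len g)
  ... | inj₁ f-none | inj₁ g-none = no-peaks f-none g-none
  ... | inj₂ (p , pk , _) | inj₁ g-none = left p pk λ q qk → ⊥-elim (g-none q qk)
  ... | inj₁ f-none | inj₂ (q , qk , _) = right q qk λ p pk → ⊥-elim (f-none p pk)
  ... | inj₂ (p , pk , f-low) | inj₂ (q , qk , g-low) with height f (suc p) ≤? height g (suc q)
  ...   | yes f≤g = left p pk λ q' qk' → ≤-trans f≤g (g-low q' qk')
  ...   | no f≰g  = right q qk λ p' pk' → ≤-trans (<⇒≤ (≰⇒> f≰g)) (f-low p' pk')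

  -- By induction on the total length, removing the lower of the
  -- lowest peaks of the two profiles.
  climb : ∀ {lo hi} (f g : Profile lo hi) → Sync (height f) (height g) (len f) (len g) 0 0
  climb f g = climb-within _ f g ≤-refl
    where
    climb-within : ∀ N {lo hi} (f g : Profile lo hi) → len f + len g ≤ N →
                   Sync (height f) (height g) (len f) (len g) 0 0
    climb-within N f g bound with lowerPeak f g
    ... | no-peaks f-none g-none = peakless-sync f g f-none g-none
    climb-within zero f g bound | left p pk _ =
      ⊥-elim (<⇒≱ (≤-<-trans z≤n (proj₁ pk)) (≤-trans (m≤m+n (len f) (len g)) bound))
    climb-within zero f g bound | right q qk _ =
      ⊥-elim (<⇒≱ (≤-<-trans z≤n (proj₁ qk)) (≤-trans (m≤n+m (len g) (len f)) bound))
    climb-within (suc N) f g bound | left p pk low =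
      uncut (climb-within N cut g (≤-pred (≤-trans (+-monoˡ-< (len g) cut-shorter) bound)))
      where open PeakRemoval f g p pk low
    climb-within (suc N) f g bound | right q qk low =
      Sync-swap (uncut (Sync-swap
        (climb-within N f cut (≤-pred (≤-trans (+-monoʳ-< (len f) cut-shorter) bound)))))
      where open PeakRemoval g f q qk low

module UniversalProfile where
  open Positions
  open MountainClimbing
  open Profile
  open import Data.Nat
  open import Data.Nat.Properties
  open import Data.Product using (Σ; _×_; _,_; proj₁; proj₂)
  open import Data.Sum using (inj₁; inj₂)
  open import Data.Empty using (⊥-elim)
  open import Relation.Nullary using (Dec; yes; no; _×-dec_)
  open import Relation.Binary.PropositionalEquality
  open import Data.Bool using (Bool; true; false; T)
  open import Data.Unit using (tt)
  open import Data.Vec using (Vec; []; _∷_)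
  open import Data.List using (List; []; _∷_; _++_; map)
  open import Data.List.Relation.Unary.All as All using (All; []; _∷_)
  open import Data.List.Relation.Unary.All.Properties using (++⁻ˡ; ++⁻ʳ)
  open import Data.List.Relation.Unary.Any using (here; there)
  open import Data.List.Membership.Propositional using (_∈_)
  open import Data.List.Membership.Propositional.Properties using (∈-map⁺; ∈-++⁺ˡ; ∈-++⁺ʳ)

  record Route (L a T : ℕ) : Set where
    field
      at       : ℕ → ℕ
      at-start : at 0 ≡ a
      at-end   : at T ≡ L
      within   : ∀ t → t ≤ T → at t ≤ L
      moves    : ∀ t → t < T → Adj (at t) (at (suc t))
  open Route

  route-arrived : ∀ {L} → Route L L 0
  route-arrived {L} = record
    { at = λ _ → L ; at-start = refl ; at-end = refl ; within = λ _ _ → ≤-refl ; moves = λ _ () }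

  route-cons : ∀ {L a a' T} → Adj a a' → a ≤ L → Route L a' T → Route L a (suc T)
  route-cons {L} {a} {T = T} a~a' a≤L r = record
    { at = at' ; at-start = refl ; at-end = at-end r ; within = within' ; moves = moves' }
    where
    at' : ℕ → ℕ
    at' zero    = a
    at' (suc t) = at r t
    within' : ∀ t → t ≤ suc T → at' t ≤ L
    within' zero    _   = a≤L
    within' (suc t) t≤T = within r t (≤-pred t≤T)
    moves' : ∀ t → t < suc T → Adj (at' t) (at' (suc t))
    moves' zero    _   = subst (Adj a) (sym (at-start r)) a~a'
    moves' (suc t) t<T = moves r t (≤-pred t<T)

  route-compose : ∀ {L L' T} → Route L' 0 T → Route L 0 L' → Route L 0 T
  route-compose r r' = record
    { at       = λ t → at r' (at r t)
    ; at-start = trans (cong (at r') (at-start r)) (at-start r')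
    ; at-end   = trans (cong (at r') (at-end r)) (at-end r')
    ; within   = λ t t≤T → within r' (at r t) (within r t t≤T)
    ; moves    = λ t t<T → steps-adjacent {R = Adj} Adj-sym {h = at r'} (moves r')
                             (within r t (<⇒≤ t<T)) (within r (suc t) t<T) (moves r t t<T)
    }

  Follows : ℕ → (ℕ → ℕ) → ℕ → (ℕ → ℕ) → Set
  Follows T V L H = Σ (Route L 0 T) λ r → ∀ t → t ≤ T → V t ≡ H (at r t)

  follows-trans : ∀ {T V LU U L H} → Follows T V LU U → Follows LU U L H → Follows T V L H
  follows-trans (r , V≡U) (r' , U≡H) =
    route-compose r r' , λ t t≤T → trans (V≡U t t≤T) (U≡H (at r t) (within r t t≤T))

  follows-resp : ∀ {T V L H H'} → (∀ t → t ≤ L → H t ≡ H' t) → Follows T V L H → Follows T V L H'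
  follows-resp H≡H' (r , V≡H) = r , λ t t≤T → trans (V≡H t t≤T) (H≡H' (at r t) (within r t t≤T))

  record Schedule (F G : ℕ → ℕ) (m n p q : ℕ) : Set where
    field
      duration : ℕ
      first    : Route m p duration
      second   : Route n q duration
      level    : ∀ t → t ≤ duration → F (at first t) ≡ G (at second t)

  schedule-cons : ∀ {F G m n p q p' q'} → Adj p p' → Adj q q' → p ≤ m → q ≤ n → F p ≡ G q →
                  Schedule F G m n p' q' → Schedule F G m n p q
  schedule-cons {F} {G} {m} {n} {p} {q} p~p' q~q' p≤m q≤n Fp≡Gq s = record
    { duration = suc (duration s) ; first = first' ; second = second' ; level = level' }
    where
    open Schedule
    first' : Route m p (suc (duration s))
    first' = route-cons p~p' p≤m (first s)
    second' : Route n q (suc (duration s))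
    second' = route-cons q~q' q≤n (second s)
    level' : ∀ t → t ≤ suc (duration s) → F (at first' t) ≡ G (at second' t)
    level' zero    _   = Fp≡Gq
    level' (suc t) t≤T = level s t (≤-pred t≤T)

  schedule : ∀ {F G m n p q} → Sync F G m n p q → p ≤ m → q ≤ n → F p ≡ G q → Schedule F G m n p q
  schedule arrived _ _ Fp≡Gq = record
    { duration = 0 ; first = route-arrived ; second = route-arrived ; level = λ _ _ → Fp≡Gq }
  schedule (move p~p' q~q' p'≤m q'≤n Fp'≡Gq' rest) p≤m q≤n Fp≡Gq =
    schedule-cons p~p' q~q' p≤m q≤n Fp≡Gq (schedule rest p'≤m q'≤n Fp'≡Gq')

  common : ∀ {lo hi} (f g : Profile lo hi) →
           Σ (Profile lo hi) λ u → Follows (len u) (height u) (len f) (height f) ×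
                                   Follows (len u) (height u) (len g) (height g)
  common {lo} {hi} f g = u , (first s , λ _ _ → refl) , (second s , level s)
    where
    open Schedule
    s : Schedule (height f) (height g) (len f) (len g) 0 0
    s = schedule (climb f g) z≤n z≤n (trans (starts f) (sym (starts g)))
    u : Profile lo hi
    u = record
      { len     = duration s
      ; height  = λ t → height f (at (first s) t)
      ; starts  = trans (cong (height f) (at-start (first s))) (starts f)
      ; ends    = trans (cong (height f) (at-end (first s))) (ends f)
      ; bounded = λ t t≤T → bounded f _ (within (first s) t t≤T)
      ; steps   = λ t t<T → steps-adjacent {R = Adj} Adj-sym {h = height f} (steps f)
                              (within (first s) t (<⇒≤ t<T)) (within (first s) (suc t) t<T)
                              (moves (first s) t t<T)
      }

  straight : ∀ {lo hi} → lo ≤ hi → Profile lo hi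
  straight {lo} {hi} lo≤hi = record
    { len     = hi ∸ lo
    ; height  = lo +_
    ; starts  = +-identityʳ lo
    ; ends    = m+[n∸m]≡n lo≤hi
    ; bounded = λ t t≤ → m≤m+n lo t , ≤-trans (+-monoʳ-≤ lo t≤) (≤-reflexive (m+[n∸m]≡n lo≤hi))
    ; steps   = λ t _ → inj₁ (sym (+-suc lo t))
    }

  _≽_ : ∀ {lo hi} → Profile lo hi → Profile lo hi → Set
  u ≽ g = Follows (len u) (height u) (len g) (height g)

  universal : ∀ {lo hi} → lo ≤ hi → List (Profile lo hi) → Profile lo hi
  universal lo≤hi []       = straight lo≤hi
  universal lo≤hi (g ∷ gs) = proj₁ (common (universal lo≤hi gs) g)

  universal-follows : ∀ {lo hi} (lo≤hi : lo ≤ hi) gs → All (universal lo≤hi gs ≽_) gs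
  universal-follows lo≤hi []       = []
  universal-follows {lo} {hi} lo≤hi (g ∷ gs) =
    proj₂ (proj₂ merged) ∷
    All.map (λ {g'} → follows-trans {H = height g'} (proj₁ (proj₂ merged))) (universal-follows lo≤hi gs)
    where
    merged : Σ (Profile lo hi) λ u → u ≽ universal lo≤hi gs × u ≽ g
    merged = common (universal lo≤hi gs) g

  IsProfile : ℕ → ℕ → ℕ → (ℕ → ℕ) → Set
  IsProfile lo hi L H = H 0 ≡ lo × H L ≡ hi × (∀ t → t < suc L → lo ≤ H t × H t ≤ hi) ×
                        (∀ t → t < L → Adj (H t) (H (suc t)))

  isProfile? : ∀ lo hi L H → Dec (IsProfile lo hi L H)
  isProfile? lo hi L H =
    (H 0 ≟ lo) ×-dec (H L ≟ hi) ×-dec all-below? (λ t → (lo ≤? H t) ×-dec (H t ≤? hi)) (suc L) ×-dec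
    all-below? (λ t → adj? (H t) (H (suc t))) L

  toProfile : ∀ {lo hi L H} → IsProfile lo hi L H → Profile lo hi
  toProfile {L = L} {H} (H0 , HL , inside , unit) = record
    { len = L ; height = H ; starts = H0 ; ends = HL
    ; bounded = λ t t≤L → inside t (s≤s t≤L) ; steps = unit }

  isProfile : ∀ {lo hi} (f : Profile lo hi) → IsProfile lo hi (len f) (height f)
  isProfile f = starts f , ends f , (λ t t<1+L → bounded f t (≤-pred t<1+L)) , steps f

  -- A profile is determined by the directions of its steps (true: up, false: down).
  stepBy : Bool → ℕ → ℕ
  stepBy true  = suc
  stepBy false = pred

  heightsFrom : ∀ {L} → ℕ → Vec Bool L → ℕ → ℕ
  heightsFrom h bs       zero    = h
  heightsFrom h []       (suc t) = h
  heightsFrom h (b ∷ bs) (suc t) = heightsFrom (stepBy b h) bs t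

  directions : (ℕ → ℕ) → ∀ L → Vec Bool L
  directions H zero    = []
  directions H (suc L) = (suc (H 0) ≡ᵇ H 1) ∷ directions (λ t → H (suc t)) L

  step-direction : ∀ {a b} → Adj a b → stepBy (suc a ≡ᵇ b) a ≡ b
  step-direction {a} {b} a~b with suc a ≡ᵇ b in up? | a~b
  ... | true  | _         = ≡ᵇ⇒≡ (suc a) b (subst T (sym up?) tt)
  ... | false | inj₁ up   = ⊥-elim (subst T up? (≡⇒≡ᵇ (suc a) b up))
  ... | false | inj₂ down = cong pred (sym down)

  heights-directions : ∀ {H L} → (∀ t → t < L → Adj (H t) (H (suc t))) →
                       ∀ t → t ≤ L → heightsFrom (H 0) (directions H L) t ≡ H t
  heights-directions         _     zero    _       = refl
  heights-directions {H} {suc L} unit (suc t) t<1+L = begin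
    heightsFrom (stepBy (suc (H 0) ≡ᵇ H 1) (H 0)) (directions (λ t → H (suc t)) L) t
      ≡⟨ cong (λ h → heightsFrom h (directions (λ t → H (suc t)) L) t) (step-direction (unit 0 z<s)) ⟩
    heightsFrom (H 1) (directions (λ t → H (suc t)) L) t
      ≡⟨ heights-directions (λ t t<L → unit (suc t) (s≤s t<L)) t (≤-pred t<1+L) ⟩
    H (suc t) ∎
    where open ≡-Reasoning

  allDirections : ∀ L → List (Vec Bool L)
  allDirections zero    = [] ∷ []
  allDirections (suc L) = map (true ∷_) (allDirections L) ++ map (false ∷_) (allDirections L)

  allDirections-complete : ∀ {L} (bs : Vec Bool L) → bs ∈ allDirections L
  allDirections-complete []          = here refl
  allDirections-complete (true ∷ bs)  = ∈-++⁺ˡ (∈-map⁺ (true ∷_) (allDirections-complete bs))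
  allDirections-complete (false ∷ bs) =
    ∈-++⁺ʳ (map (true ∷_) _) (∈-map⁺ (false ∷_) (allDirections-complete bs))

  IsProfile-resp : ∀ {lo hi L H H'} → (∀ t → t ≤ L → H t ≡ H' t) →
                   IsProfile lo hi L H → IsProfile lo hi L H'
  IsProfile-resp {L = L} {H} {H'} H≡H' (H0 , HL , inside , unit) =
    trans (sym (H≡H' 0 z≤n)) H0 , trans (sym (H≡H' L ≤-refl)) HL ,
    (λ t t<1+L → subst (λ h → _ ≤ h × h ≤ _) (H≡H' t (≤-pred t<1+L)) (inside t t<1+L)) ,
    (λ t t<L → subst₂ Adj (H≡H' t (<⇒≤ t<L)) (H≡H' (suc t) t<L) (unit t t<L))

  module _ (lo hi : ℕ) where
    profilesAmong : ∀ {L} → List (Vec Bool L) → List (Profile lo hi)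
    profilesAmong []                = []
    profilesAmong {L} (bs ∷ bss) with isProfile? lo hi L (heightsFrom lo bs)
    ... | yes isP = toProfile isP ∷ profilesAmong bss
    ... | no _    = profilesAmong bss

    profilesUpTo : ℕ → List (Profile lo hi)
    profilesUpTo zero    = profilesAmong (allDirections 0)
    profilesUpTo (suc K) = profilesAmong (allDirections (suc K)) ++ profilesUpTo K

    module _ {Q : ℕ → (ℕ → ℕ) → Set} where
      Listed : List (Profile lo hi) → Set
      Listed = All (λ g → Q (len g) (height g))

      among-covers : ∀ {L} {bs : Vec Bool L} {bss} → bs ∈ bss → IsProfile lo hi L (heightsFrom lo bs) →
                     Listed (profilesAmong bss) → Q L (heightsFrom lo bs)
      among-covers {L} {bs} (here refl) isP listed with isProfile? lo hi L (heightsFrom lo bs)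
      ... | yes _   = All.head listed
      ... | no ¬isP = ⊥-elim (¬isP isP)
      among-covers {L} {bss = bs' ∷ _} (there mem) isP listed with isProfile? lo hi L (heightsFrom lo bs')
      ... | yes _ = among-covers mem isP (All.tail listed)
      ... | no _  = among-covers mem isP listed

      upTo-covers : ∀ K {L} (bs : Vec Bool L) → L ≤ K → IsProfile lo hi L (heightsFrom lo bs) →
                    Listed (profilesUpTo K) → Q L (heightsFrom lo bs)
      upTo-covers zero    bs z≤n isP listed = among-covers (allDirections-complete bs) isP listed
      upTo-covers (suc K) bs L≤K isP listed with m≤n⇒m<n∨m≡n L≤K
      ... | inj₁ L<1+K = upTo-covers K bs (≤-pred L<1+K) isP (++⁻ʳ _ listed)
      ... | inj₂ refl  = among-covers (allDirections-complete bs) isP (++⁻ˡ _ listed)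

  module _ {lo hi} (lo≤hi : lo ≤ hi) (K : ℕ) where
    universalUpTo : Profile lo hi
    universalUpTo = universal lo≤hi (profilesUpTo lo hi K)

    universalUpTo-follows : (f : Profile lo hi) → len f ≤ K → universalUpTo ≽ f
    universalUpTo-follows f len≤K = follows-resp decoded≡ (upTo-covers lo hi K bs len≤K decoded-profile
                                                          (universal-follows lo≤hi (profilesUpTo lo hi K)))
      where
      bs : Vec Bool (len f)
      bs = directions (height f) (len f)

      decoded≡ : ∀ t → t ≤ len f → heightsFrom lo bs t ≡ height f t
      decoded≡ t t≤ =
        subst (λ h → heightsFrom h bs t ≡ height f t) (starts f) (heights-directions (steps f) t t≤)

      decoded-profile : IsProfile lo hi (len f) (heightsFrom lo bs)
      decoded-profile = IsProfile-resp (λ t t≤ → sym (decoded≡ t t≤)) (isProfile f)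

module Walks {V : Set} (E : V → V → Set) where
  open Positions using (jump; jump-low; jump-high)
  open import Data.Nat
  open import Data.Nat.Properties
  open import Data.Fin using (Fin; toℕ)
  open import Data.Fin.Properties using (pigeonhole; toℕ<n)
  open import Data.Product using (Σ; _,_)
  open import Data.Sum using (inj₁; inj₂)
  open import Relation.Nullary using (yes; no)
  open import Relation.Binary.PropositionalEquality
  open import Relation.Binary.Definitions using (tri<; tri≈; tri>)
  open import Relation.Binary.Construct.Closure.ReflexiveTransitive using (Star; ε; _◅_)

  record Walk (u v : V) : Set where
    field
      len      : ℕ
      at       : ℕ → V
      at-start : at 0 ≡ u
      at-end   : at len ≡ v
      steps    : ∀ t → t < len → E (at t) (at (suc t))
  open Walk

  walk-cons : ∀ {u w v} → E u w → Walk w v → Walk u v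
  walk-cons {u} e W = record
    { len = suc (len W) ; at = at' ; at-start = refl ; at-end = at-end W ; steps = steps' }
    where
    at' : ℕ → V
    at' zero    = u
    at' (suc t) = at W t
    steps' : ∀ t → t < suc (len W) → E (at' t) (at' (suc t))
    steps' zero    _      = subst (E u) (sym (at-start W)) e
    steps' (suc t) t<len  = steps W t (≤-pred t<len)

  fromStar : ∀ {u v} → Star E u v → Walk u v
  fromStar {u} ε  = record { len = 0 ; at = λ _ → u ; at-start = refl ; at-end = refl ; steps = λ _ () }
  fromStar (e ◅ path) = walk-cons e (fromStar path)

  cut-loop : ∀ {u v} (W : Walk u v) {a e L'} → e + L' ≡ len W → a ≤ L' → at W a ≡ at W (e + a) →
             Σ (Walk u v) λ W' → len W' ≡ L'
  cut-loop {u} {v} W {a} {e} {L'} e+L'≡len a≤L' loop = W' , refl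
    where
    inside : ∀ {t} → t < L' → e + t < len W
    inside {t} t<L' = subst (e + t <_) e+L'≡len (+-monoʳ-< e t<L')

    steps' : ∀ t → t < L' → E (at W (jump e a t)) (at W (jump e a (suc t)))
    steps' t t<L' with <-cmp t a
    ... | tri< t<a _ _ = subst₂ (λ x y → E (at W x) (at W y)) (sym (jump-low (<⇒≤ t<a))) (sym (jump-low t<a))
                           (steps W t (≤-trans t<a (≤-trans a≤L' (subst (L' ≤_) e+L'≡len (m≤n+m L' e)))))
    ... | tri≈ _ refl _ = subst₂ E (trans (sym loop) (cong (at W) (sym (jump-low ≤-refl))))
                            (cong (at W) (sym (trans (jump-high (n<1+n t)) (+-suc e t))))
                            (steps W (e + t) (inside t<L'))
    ... | tri> _ _ a<t = subst₂ (λ x y → E (at W x) (at W y)) (sym (jump-high a<t))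
                           (sym (trans (jump-high (m<n⇒m<1+n a<t)) (+-suc e t)))
                           (steps W (e + t) (inside t<L'))

    end : at W (jump e a L') ≡ v
    end with m≤n⇒m<n∨m≡n a≤L'
    ... | inj₁ a<L' = trans (cong (at W) (trans (jump-high a<L') e+L'≡len)) (at-end W)
    ... | inj₂ refl =
      trans (cong (at W) (jump-low ≤-refl)) (trans loop (trans (cong (at W) e+L'≡len) (at-end W)))

    W' : Walk u v
    W' = record
      { len = L' ; at = λ t → at W (jump e a t) ; at-start = at-start W ; at-end = end ; steps = steps' }

  -- If the vertices are coded injectively by Fin K, every walk can be shortened to length at most K:
  -- a longer walk visits some vertex twice, and the loop in between can be cut out.
  module _ {K} (code : V → Fin K) (code-injective : ∀ {x y} → code x ≡ code y → x ≡ y) where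
    shorten : ∀ {u v} → Walk u v → Σ (Walk u v) λ W' → len W' ≤ K
    shorten W = shorten-within (len W) W ≤-refl
      where
      shorten-within : ∀ N {u v} (W : Walk u v) → len W ≤ N → Σ (Walk u v) λ W' → len W' ≤ K
      shorten-within N W len≤N with len W ≤? K
      ... | yes short = W , short
      shorten-within zero    W len≤N | no long = W , ≤-trans len≤N z≤n
      shorten-within (suc N) W len≤N | no long
        with pigeonhole (s≤s (<⇒≤ (≰⇒> long))) (λ t → code (at W (toℕ t)))
      ... | t₁ , t₂ , t₁<t₂ , same-code =
        let W' , len'≡ = cut-loop W {toℕ t₁} {toℕ t₂ ∸ toℕ t₁} e+L'≡len a≤L' loop
        in shorten-within N W' (≤-pred (≤-trans (subst (_< len W) (sym len'≡) shorter) len≤N))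
        where
        e : ℕ
        e = toℕ t₂ ∸ toℕ t₁
        t₂≤len : toℕ t₂ ≤ len W
        t₂≤len = ≤-pred (toℕ<n t₂)
        e+a≡t₂ : e + toℕ t₁ ≡ toℕ t₂
        e+a≡t₂ = m∸n+n≡m (<⇒≤ t₁<t₂)
        e+L'≡len : e + (len W ∸ e) ≡ len W
        e+L'≡len = m+[n∸m]≡n (≤-trans (m∸n≤m (toℕ t₂) (toℕ t₁)) t₂≤len)
        a≤L' : toℕ t₁ ≤ len W ∸ e
        a≤L' = +-cancelˡ-≤ e _ _ (subst₂ _≤_ (sym e+a≡t₂) (sym e+L'≡len) t₂≤len)
        loop : at W (toℕ t₁) ≡ at W (e + toℕ t₁)
        loop = trans (code-injective same-code) (cong (at W) (sym e+a≡t₂))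
        shorter : len W ∸ e < len W
        shorter = subst (len W ∸ e <_) e+L'≡len (m<n+m (len W ∸ e) (m<n⇒0<n∸m t₁<t₂))

-- The graph Conn(I_[i,j]) and the relations on A that its walks induce.
module Conn (𝔸 : Structure) (I : PathInstance 𝔸) (i j : Fin (suc (PathInstance.m I)))
               (i≤j : toℕ i ≤ toℕ j) where
  open Positions using (Adj; steps-adjacent)
  open MountainClimbing using (Profile)
  open UniversalProfile using (Route; universalUpTo; universalUpTo-follows)
  open import Data.Nat using (ℕ; zero; suc; _≤_; _*_; z≤n)
  open import Data.Nat.Properties
    using (≤-refl; ≤-trans; <⇒≤; ≤-pred; ≤-irrelevant; n<1+n; n≤1+n; m<n⇒m<1+n; <-irrefl)
  open import Data.Fin using (Fin; toℕ; fromℕ<; inject₁; combine) renaming (zero to fzero; suc to fsuc)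
  open import Data.Fin.Properties using (toℕ-injective; toℕ-inject₁; toℕ-fromℕ<; toℕ<n; combine-injective)
  open import Data.Bool.Properties using (T-irrelevant)
  open import Data.Vec using (Vec; []; _∷_; lookup)
  open import Data.Vec as Vec using ()
  open import Data.List using (_∷_; [])
  open import Data.List.Relation.Unary.All using (_∷_; [])
  open import Data.Product using (Σ; _×_; _,_; proj₁; proj₂)
  open import Data.Sum using (inj₁; inj₂)
  open import Data.Empty using (⊥-elim)
  open import Function using (id)
  open import Relation.Binary.PropositionalEquality
  open import Relation.Binary.Construct.Closure.Symmetric using (SymClosure; fwd; bwd; symmetric)
  open import Relation.Binary.Construct.Closure.ReflexiveTransitive using (Star; ε; _◅_; _◅◅_)

  open Structure 𝔸 using (Carrier)
  open PathInstance I
  open PPClosure 𝔸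

  lo hi : ℕ
  lo = toℕ i
  hi = toℕ j

  Vtx : Set
  Vtx = Vertex i j

  Link : Vtx → Vtx → Set
  Link = SymClosure Edge

  layer : Vtx → ℕ
  layer u = toℕ (proj₁ u)

  elt : Vtx → Carrier
  elt u = proj₁ (proj₂ (proj₂ u))

  vertex : (k : Fin (suc m)) → lo ≤ toℕ k → toℕ k ≤ hi → ∀ {x} → B k x → Vtx
  vertex k lo≤k k≤hi {x} x∈ = k , (lo≤k , k≤hi) , x , x∈

  vertex-≡ : ∀ {u v} → layer u ≡ layer v → elt u ≡ elt v → u ≡ v
  vertex-≡ {k , (b₁ , b₂) , x , x∈} {k' , (b₁' , b₂') , .x , x∈'} k≡k' refl with toℕ-injective k≡k'
  ... | refl rewrite ≤-irrelevant b₁ b₁' | ≤-irrelevant b₂ b₂' | T-irrelevant x∈ x∈' = refl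

  in-layer : ∀ (u : Vtx) {k} → layer u ≡ toℕ k → B k (elt u)
  in-layer (k' , _ , x , x∈) k'≡k = subst (λ k → B k x) (toℕ-injective k'≡k) x∈

  edge-layers : ∀ {u v} → Edge {i} {j} u v → suc (layer u) ≡ layer v
  edge-layers (e , u≡ , v≡ , _) = trans (cong suc (trans (cong toℕ u≡) (toℕ-inject₁ e))) (cong toℕ (sym v≡))

  link-layers : ∀ {u v} → Link u v → Adj (layer u) (layer v)
  link-layers {u} {v} (fwd edge) = inj₁ (edge-layers {u} {v} edge)
  link-layers {u} {v} (bwd edge) = inj₂ (edge-layers {v} {u} edge)

  open Walks Link
  open Walk

  walk-profile : ∀ {u v} → layer u ≡ lo → layer v ≡ hi → Walk u v → Profile lo hi
  walk-profile u-lo v-hi W = record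
    { len     = len W
    ; height  = λ t → layer (at W t)
    ; starts  = trans (cong layer (at-start W)) u-lo
    ; ends    = trans (cong layer (at-end W)) v-hi
    ; bounded = λ t _ → proj₁ (proj₂ (at W t))
    ; steps   = λ t t<len → link-layers (steps W t t<len)
    }

  Realises : (ℕ → ℕ) → ℕ → Vtx → Vtx → Set
  Realises H zero    u v = u ≡ v × layer v ≡ H 0
  Realises H (suc t) u v = Σ Vtx λ w → Realises H t u w × Link w v × layer v ≡ H (suc t)

  realised-layer : ∀ {H t u v} → Realises H t u v → layer v ≡ H t
  realised-layer {t = zero}  (_ , v-layer)         = v-layer
  realised-layer {t = suc t} (_ , _ , _ , v-layer) = v-layer

  realised-start : ∀ {H t u v} → Realises H t u v → layer u ≡ H 0
  realised-start {t = zero}  (refl , u-layer)  = u-layer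
  realised-start {t = suc t} (_ , before , _) = realised-start before

  realised-path : ∀ {H t u v} → Realises H t u v → Star Link u v
  realised-path {t = zero}  (refl , _)              = ε
  realised-path {t = suc t} (_ , before , link , _) = realised-path before ◅◅ (link ◅ ε)

  follow-walk : ∀ {u v} (W : Walk u v) {T H} → (r : Route (len W) 0 T) →
                (∀ t → t ≤ T → H t ≡ layer (at W (Route.at r t))) → Realises H T u v
  follow-walk {u} {v} W {T} {H} r H≡ = subst₂ (Realises H T) start end (realise T ≤-refl)
    where
    visit : ℕ → Vtx
    visit t = at W (Route.at r t)

    realise : ∀ t → t ≤ T → Realises H t (visit 0) (visit t)
    realise zero    _   = refl , sym (H≡ 0 z≤n)
    realise (suc t) t<T = visit t , realise t (<⇒≤ t<T) ,
      steps-adjacent {R = Link} (symmetric Edge) (steps W)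
                     (Route.within r t (<⇒≤ t<T)) (Route.within r (suc t) t<T) (Route.moves r t t<T) ,
      sym (H≡ (suc t) t<T)

    start : visit 0 ≡ u
    start = trans (cong (at W) (Route.at-start r)) (at-start W)

    end : visit T ≡ v
    end = trans (cong (at W) (Route.at-end r)) (at-end W)

  Trace : (ℕ → ℕ) → ℕ → Vec Carrier 2 → Set
  Trace H t (a ∷ b ∷ []) = Σ Vtx λ u → Σ Vtx λ v → elt u ≡ a × elt v ≡ b × Realises H t u v

  Step : ℕ → ℕ → Vec Carrier 2 → Set
  Step k k' (x ∷ y ∷ []) =
    Σ Vtx λ u → Σ Vtx λ v → elt u ≡ x × elt v ≡ y × layer u ≡ k × layer v ≡ k' × Link u v

  Diag : Fin (suc m) → Vec Carrier 2 → Set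
  Diag k (x ∷ y ∷ []) = x ≡ y × B k x

  trace-zero : ∀ {H} k → H 0 ≡ toℕ k → lo ≤ toℕ k → toℕ k ≤ hi → Diag k ≐ Trace H 0
  trace-zero {H} k H0≡k lo≤k k≤hi (x ∷ y ∷ []) = to , from
    where
    to : Diag k (x ∷ y ∷ []) → Trace H 0 (x ∷ y ∷ [])
    to (refl , x∈) = let u = vertex k lo≤k k≤hi x∈ in u , u , refl , refl , refl , sym H0≡k
    from : Trace H 0 (x ∷ y ∷ []) → Diag k (x ∷ y ∷ [])
    from (u , .u , refl , refl , refl , u-layer) = refl , in-layer u (trans u-layer H0≡k)

  trace-suc : ∀ {H t} → (Trace H t ⨾ Step (H t) (H (suc t))) ≐ Trace H (suc t)
  trace-suc {H} {t} (a ∷ b ∷ []) = to , from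
    where
    to : (Trace H t ⨾ Step (H t) (H (suc t))) (a ∷ b ∷ []) → Trace H (suc t) (a ∷ b ∷ [])
    to (y , (u , w , refl , refl , before) , (w' , v , w'≡ , refl , w'-layer , v-layer , link)) =
      u , v , refl , refl , w , before , subst (λ x → Link x v) same link , v-layer
      where
      same : w' ≡ w
      same = vertex-≡ (trans w'-layer (sym (realised-layer before))) w'≡
    from : Trace H (suc t) (a ∷ b ∷ []) → (Trace H t ⨾ Step (H t) (H (suc t))) (a ∷ b ∷ [])
    from (u , v , refl , refl , w , before , link , v-layer) =
      elt w , (u , w , refl , refl , before) , (w , v , refl , refl , realised-layer before , v-layer , link)

  Step-swap : ∀ {k k' x y} → Step k k' (x ∷ y ∷ []) → Step k' k (y ∷ x ∷ [])
  Step-swap (u , v , u-elt , v-elt , u-layer , v-layer , link) =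
    v , u , v-elt , u-elt , v-layer , u-layer , symmetric Edge link

  unary-atom : ∀ {v} → Fin (suc m) → Fin v → Atom 𝔸 v
  unary-atom {v} k x = rel-atom (unary k) (subst (Vec (Fin v)) (sym (unary-ar k)) (x ∷ []))

  binary-atom : ∀ {v} → Fin m → Fin v → Fin v → Atom 𝔸 v
  binary-atom {v} e x y = rel-atom (binary e) (subst (Vec (Fin v)) (sym (binary-ar e)) (x ∷ y ∷ []))

  map-subst : ∀ {A C : Set} (f : A → C) {k l} (k≡l : k ≡ l) (xs : Vec A l) →
              Vec.map f (subst (Vec A) (sym k≡l) xs) ≡ subst (Vec C) (sym k≡l) (Vec.map f xs)
  map-subst f refl xs = refl

  unary-atom-sem : ∀ {v} k x (σ : Vec Carrier v) → ⟦_⟧ᵃ 𝔸 (unary-atom k x) σ ≡ B k (lookup σ x)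
  unary-atom-sem k x σ = cong (unary k ∋ʳ_) (map-subst (lookup σ) (unary-ar k) (x ∷ []))
    where open Structure 𝔸 using (_∋ʳ_)

  binary-atom-sem : ∀ {v} e x y (σ : Vec Carrier v) →
                    ⟦_⟧ᵃ 𝔸 (binary-atom e x y) σ ≡ Bₑ e (lookup σ x) (lookup σ y)
  binary-atom-sem e x y σ = cong (binary e ∋ʳ_) (map-subst (lookup σ) (binary-ar e) (x ∷ y ∷ []))
    where open Structure 𝔸 using (_∋ʳ_)

  diag-pp : ∀ k → InRelClone 𝔸 2 (Diag k)
  diag-pp k = φ , λ { (x ∷ y ∷ []) → to x y , from x y }
    where
    φ : PPFormula 𝔸 2
    φ = record { q = 0 ; atoms = eq-atom fzero (fsuc fzero) ∷ unary-atom k fzero ∷ [] }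
    to : ∀ x y → Diag k (x ∷ y ∷ []) → ⟦_⟧ 𝔸 φ (x ∷ y ∷ [])
    to x y (x≡y , x∈) = [] , x≡y ∷ subst id (sym (unary-atom-sem k fzero (x ∷ y ∷ []))) x∈ ∷ []
    from : ∀ x y → ⟦_⟧ 𝔸 φ (x ∷ y ∷ []) → Diag k (x ∷ y ∷ [])
    from x y ([] , x≡y ∷ x∈ ∷ []) = x≡y , subst id (unary-atom-sem k fzero (x ∷ y ∷ [])) x∈

  EdgeAt : Fin m → Carrier → Carrier → Set
  EdgeAt e x y = Bₑ e x y × B (inject₁ e) x × B (fsuc e) y

  edge-formula : Fin m → Fin 2 → Fin 2 → PPFormula 𝔸 2
  edge-formula e x y = record
    { q = 0 ; atoms = binary-atom e x y ∷ unary-atom (inject₁ e) x ∷ unary-atom (fsuc e) y ∷ [] }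

  edge-formula-sem : ∀ e x y (σ : Vec Carrier 2) →
                     (EdgeAt e (lookup σ x) (lookup σ y) → ⟦_⟧ 𝔸 (edge-formula e x y) σ) ×
                     (⟦_⟧ 𝔸 (edge-formula e x y) σ → EdgeAt e (lookup σ x) (lookup σ y))
  edge-formula-sem e x y σ@(_ ∷ _ ∷ []) = to , from
    where
    to : EdgeAt e (lookup σ x) (lookup σ y) → ⟦_⟧ 𝔸 (edge-formula e x y) σ
    to (xy∈ , x∈ , y∈) = [] , subst id (sym (binary-atom-sem e x y σ)) xy∈
                          ∷ subst id (sym (unary-atom-sem (inject₁ e) x σ)) x∈
                          ∷ subst id (sym (unary-atom-sem (fsuc e) y σ)) y∈ ∷ []
    from : ⟦_⟧ 𝔸 (edge-formula e x y) σ → EdgeAt e (lookup σ x) (lookup σ y)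
    from ([] , xy∈ ∷ x∈ ∷ y∈ ∷ []) = subst id (binary-atom-sem e x y σ) xy∈ ,
                                     subst id (unary-atom-sem (inject₁ e) x σ) x∈ ,
                                     subst id (unary-atom-sem (fsuc e) y σ) y∈

  step-edge : ∀ e {k} → toℕ e ≡ k → lo ≤ k → suc k ≤ hi → ∀ x y →
              (Step k (suc k) (x ∷ y ∷ []) → EdgeAt e x y) × (EdgeAt e x y → Step k (suc k) (x ∷ y ∷ []))
  step-edge e {k} e≡k lo≤k 1+k≤hi x y = to , from
    where
    e-layer : toℕ (inject₁ e) ≡ k
    e-layer = trans (toℕ-inject₁ e) e≡k

    to : Step k (suc k) (x ∷ y ∷ []) → EdgeAt e x y
    to (u , v , refl , refl , u-layer , v-layer , fwd (e' , u≡ , v≡ , xy∈)) =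
      subst (λ e → Bₑ e x y) e'≡e xy∈ , in-layer u (trans u-layer (sym e-layer)) ,
      in-layer v (trans v-layer (cong suc (sym e≡k)))
      where
      e'≡e : e' ≡ e
      e'≡e = toℕ-injective (trans (sym (toℕ-inject₁ e')) (trans (cong toℕ (sym u≡)) (trans u-layer (sym e≡k))))
    to (u , v , refl , refl , u-layer , v-layer , bwd edge) =
      ⊥-elim (<-irrefl (trans (sym u-layer) two-up) (m<n⇒m<1+n (n<1+n k)))
      where
      two-up : layer u ≡ suc (suc k)
      two-up = trans (sym (edge-layers {v} {u} edge)) (cong suc v-layer)

    from : EdgeAt e x y → Step k (suc k) (x ∷ y ∷ [])
    from (xy∈ , x∈ , y∈) =
      vertex (inject₁ e) (subst (lo ≤_) (sym e-layer) lo≤k)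
                         (subst (_≤ hi) (sym e-layer) (≤-trans (n≤1+n k) 1+k≤hi)) x∈ ,
      vertex (fsuc e) (subst (λ k → lo ≤ suc k) (sym e≡k) (≤-trans lo≤k (n≤1+n k)))
                      (subst (λ k → suc k ≤ hi) (sym e≡k) 1+k≤hi) y∈ ,
      refl , refl , e-layer , cong suc e≡k , fwd (e , refl , refl , xy∈)

  hi≤m : hi ≤ m
  hi≤m = ≤-pred (toℕ<n j)

  module _ {k} (lo≤k : lo ≤ k) (1+k≤hi : suc k ≤ hi) where
    private
      e : Fin m
      e = fromℕ< (≤-trans 1+k≤hi hi≤m)

      edge : ∀ x y → (Step k (suc k) (x ∷ y ∷ []) → EdgeAt e x y) ×
                     (EdgeAt e x y → Step k (suc k) (x ∷ y ∷ []))
      edge = step-edge e (toℕ-fromℕ< _) lo≤k 1+k≤hi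

    up-pp : InRelClone 𝔸 2 (Step k (suc k))
    up-pp = edge-formula e fzero (fsuc fzero) , λ { (x ∷ y ∷ []) →
      (λ s → proj₁ (edge-formula-sem e _ _ (x ∷ y ∷ [])) (proj₁ (edge x y) s)) ,
      (λ f → proj₂ (edge x y) (proj₂ (edge-formula-sem e _ _ (x ∷ y ∷ [])) f)) }

    down-pp : InRelClone 𝔸 2 (Step (suc k) k)
    down-pp = edge-formula e (fsuc fzero) fzero , λ { (x ∷ y ∷ []) →
      (λ s → proj₁ (edge-formula-sem e _ _ (x ∷ y ∷ [])) (proj₁ (edge y x) (Step-swap s))) ,
      (λ f → Step-swap (proj₂ (edge y x) (proj₂ (edge-formula-sem e _ _ (x ∷ y ∷ [])) f))) }

  step-pp : ∀ {k k'} → Adj k k' → lo ≤ k × k ≤ hi → lo ≤ k' × k' ≤ hi → InRelClone 𝔸 2 (Step k k')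
  step-pp (inj₁ refl) (lo≤k , _) (_ , 1+k≤hi) = up-pp lo≤k 1+k≤hi
  step-pp (inj₂ refl) (_ , 1+k≤hi) (lo≤k , _) = down-pp lo≤k 1+k≤hi

  trace-pp : (f : Profile lo hi) → ∀ t → t ≤ Profile.len f → InRelClone 𝔸 2 (Trace (Profile.height f) t)
  trace-pp f zero    _     = InRelClone-resp (trace-zero i (Profile.starts f) ≤-refl i≤j) (diag-pp i)
  trace-pp f (suc t) t<len =
    InRelClone-resp trace-suc
      (InRelClone-⨾ (trace-pp f t (<⇒≤ t<len))
                    (step-pp (Profile.steps f t t<len) (Profile.bounded f t (<⇒≤ t<len))
                             (Profile.bounded f (suc t) t<len)))

  -- Vertices are coded injectively by their layer and element, so walks can be shortened to
  -- length at most K.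
  K : ℕ
  K = suc m * Structure.n 𝔸

  code : Vtx → Fin K
  code u = combine (proj₁ u) (elt u)

  code-injective : ∀ {u v} → code u ≡ code v → u ≡ v
  code-injective {u} {v} same =
    vertex-≡ (cong toℕ (proj₁ parts)) (proj₂ parts)
    where
    parts : proj₁ u ≡ proj₁ v × elt u ≡ elt v
    parts = combine-injective (proj₁ u) (elt u) (proj₁ v) (elt v) same

  U : Profile lo hi
  U = universalUpTo i≤j K

  -- λ_{I,i,j} is the set of traces of U: a connecting walk may be shortened, and U follows its
  -- profile; conversely a realisation of U is a connecting walk.
  trace≐λ : Trace (Profile.height U) (Profile.len U) ≐ λ-tuple 𝔸 I i j i≤j
  trace≐λ (a ∷ b ∷ []) = sound , complete
    where
    sound : Trace (Profile.height U) (Profile.len U) (a ∷ b ∷ []) → λ-rel i j i≤j a b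
    sound (u , v , refl , refl , realisation) =
      a∈ , b∈ ,
      subst₂ (Star Link) (vertex-≡ u-layer refl) (vertex-≡ v-layer refl) (realised-path realisation)
      where
      u-layer : layer u ≡ lo
      u-layer = trans (realised-start realisation) (Profile.starts U)
      v-layer : layer v ≡ hi
      v-layer = trans (realised-layer realisation) (Profile.ends U)
      a∈ : B i (elt u)
      a∈ = in-layer u u-layer
      b∈ : B j (elt v)
      b∈ = in-layer v v-layer

    complete : λ-rel i j i≤j a b → Trace (Profile.height U) (Profile.len U) (a ∷ b ∷ [])
    complete (a∈ , b∈ , path) with shorten code code-injective (fromStar path)
    ... | W , short with universalUpTo-follows i≤j K (walk-profile refl refl W) short
    ...   | route , U≡ = _ , _ , refl , refl , follow-walk W route U≡

lemma17 : (𝔸 : Structure) (I : PathInstance 𝔸)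
    (i j : Fin (suc (PathInstance.m I))) (i≤j : toℕ i ≤ toℕ j) →
    InRelClone 𝔸 2 (λ-tuple 𝔸 I i j i≤j)
lemma17 𝔸 I i j i≤j = InRelClone-resp trace≐λ (trace-pp U (Profile.len U) ≤-refl)
  where
  open PPClosure 𝔸
  open MountainClimbing using (module Profile)
  open Conn 𝔸 I i j i≤j
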